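{- For integers $0\le k\le p$, the number $\gamma_{k,p,k}$ of signed $(p,k)$-involutions with exactly $k$ 2-cycles equals the number $c_{p+k,\,p-k}$ of involutions in the symmetric group $S_{p+k}$ having exactly $p-k$ fixed points. Consequently, for every $n$ and $r$ with $n\equiv r \pmod 2$ and $0\le r\le n$, $c_{n,r}=\gamma_{(n-r)/2,\,(n+r)/2,\,(n-r)/2}$.
   Context: Let $p,q\ge 0$ be integers and $n=p+q$. A signed $(p,q)$-involution is an involution $\pi$ of $\{1,\dots,n\}$ together with an assignment of a sign $+$ or $-$ to each fixed point of $\pi$, such that (number of $+$ signs) $-$ (number of $-$ signs) $=p-q$. $\gamma_{k,p,q}$ denotes the number of signed $(p,q)$-involutions with exactly $k$ 2-cycles. $c_{n,r}$ denotes the number of involutions in $S_n$ with exactly $r$ fixed points. -}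

module Defs where

open import Data.Nat using (ℕ; zero; suc; _+_; _*_; _≡ᵇ_)
open import Data.Bool using (Bool; true; false; _∧_; not; if_then_else_)
open import Data.Fin using (Fin)
open import Data.Fin.Properties using (_≟_)
open import Data.Vec using (Vec; []; _∷_; lookup)
open import Data.List using (List; []; _∷_; map; concatMap; length; filterᵇ; allFin; cartesianProduct)
open import Data.Product using (_×_; _,_)
open import Relation.Nullary.Decidable using (⌊_⌋)
import Data.Bool.ListAction

allVecs : {A : Set} → List A → (n : ℕ) → List (Vec A n)
allVecs xs zero    = [] ∷ []
allVecs xs (suc n) = concatMap (λ x → map (x ∷_) (allVecs xs n)) xs

allMaps : (n : ℕ) → List (Vec (Fin n) n)
allMaps n = allVecs (allFin n) n

-- All sign vectors of length n (true = '+', false = '-').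
allSigns : (n : ℕ) → List (Vec Bool n)
allSigns n = allVecs (true ∷ false ∷ []) n

allᵇ : (n : ℕ) → (Fin n → Bool) → Bool
allᵇ n P = Data.Bool.ListAction.all P (allFin n)

countᵇ : (n : ℕ) → (Fin n → Bool) → ℕ
countᵇ n P = length (filterᵇ P (allFin n))

isFixed : {n : ℕ} → Vec (Fin n) n → Fin n → Bool
isFixed π i = ⌊ lookup π i ≟ i ⌋

isInvolution : {n : ℕ} → Vec (Fin n) n → Bool
isInvolution {n} π = allᵇ n (λ i → ⌊ lookup π (lookup π i) ≟ i ⌋)

fixedPoints : {n : ℕ} → Vec (Fin n) n → ℕ
fixedPoints {n} π = countᵇ n (isFixed π)

c : ℕ → ℕ → ℕ
c n r = length (filterᵇ (λ π → isInvolution π ∧ (fixedPoints π ≡ᵇ r)) (allMaps n))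

-- A signed involution is encoded as a pair (π , s) where the sign vector s
-- is only meaningful on fixed points; to count each signed involution once,
-- non-fixed points are required to carry the dummy value true.
signsNormalised : {n : ℕ} → Vec (Fin n) n → Vec Bool n → Bool
signsNormalised {n} π s = allᵇ n (λ i → if isFixed π i then true else lookup s i)

plusCount : {n : ℕ} → Vec (Fin n) n → Vec Bool n → ℕ
plusCount {n} π s = countᵇ n (λ i → isFixed π i ∧ lookup s i)

minusCount : {n : ℕ} → Vec (Fin n) n → Vec Bool n → ℕ
minusCount {n} π s = countᵇ n (λ i → isFixed π i ∧ not (lookup s i))

-- γ k p q : number of signed (p,q)-involutions (of {1..p+q}) with exactly k
-- 2-cycles.  (#plus − #minus = p − q is written #plus + q = #minus + p;
-- "k 2-cycles" means the number of non-fixed points is 2k, i.e.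
-- fixedPoints + 2k = p + q.)
γ : ℕ → ℕ → ℕ → ℕ
γ k p q = length (filterᵇ ok (cartesianProduct (allMaps (p + q)) (allSigns (p + q))))
  where
  ok : Vec (Fin (p + q)) (p + q) × Vec Bool (p + q) → Bool
  ok (π , s) = isInvolution π ∧ signsNormalised π s
             ∧ ((plusCount π s + q) ≡ᵇ (minusCount π s + p))
             ∧ ((fixedPoints π + 2 * k) ≡ᵇ (p + q))

-- In a signed (p,k)-involution with k 2-cycles there are p − k fixed points,
-- so #plus + #minus = p − k while #plus − #minus = p − k: every fixed point is
-- signed +.  The signs thus carry no information, and forgetting them is a
-- bijection onto the involutions of S_{p+k} with p − k fixed points.  When
-- n ≡ r (mod 2), the substitution p = (n + r)/2, k = (n − r)/2 inverts
-- n = p + k, r = p − k.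
module Submission where

open import Defs
open import Data.Nat using (ℕ; _+_; _∸_; _≤_; _/_; _%_)
open import Data.Product using (_×_)
open import Relation.Binary.PropositionalEquality using (_≡_)

open import Data.Bool using (Bool; true; false; T; T?; _∧_; not; if_then_else_)
open import Data.Bool.Properties using (T-∧)
open import Data.Fin using (Fin; zero; suc)
open import Data.List using (List; []; _∷_; map; _++_; length; filterᵇ; allFin; cartesianProduct)
open import Data.List.Properties using (length-++; filter-++; filter-≐; filter-none; filter-some)
open import Data.List.Membership.Propositional using (_∈_)
open import Data.List.Membership.Propositional.Properties using (∈-allFin)
open import Data.List.Relation.Unary.All using (universal; lookup)
open import Data.List.Relation.Unary.All.Properties using (all⁺; all⁻)
import Data.List.Relation.Unary.Any as Any
open import Data.Nat using (zero; suc; _*_; _≡ᵇ_)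
open import Data.Nat.Properties
  using ( +-suc; +-identityʳ; +-cancelʳ-≡; >⇒≢; m+n≡0⇒m≡0; m+n∸n≡m; m∸n+n≡m; m+[n∸m]≡n; m≤n+m
        ; ≡ᵇ⇒≡; ≡⇒≡ᵇ)
open import Data.Nat.DivMod using (m*n/n≡m)
open import Data.Nat.Divisibility using (divides; m%n≡0⇒n∣m)
open import Data.Nat.Tactic.RingSolver using (solve-∀)
open import Data.Product using (_,_)
open import Data.Vec using (Vec; []; _∷_)
import Data.Vec as Vec
open import Function using (_∘_; _⇔_; mk⇔; Equivalence)
open import Relation.Nullary using (¬_; contradiction)
open import Relation.Binary.PropositionalEquality using (refl; sym; trans; cong; cong₂; module ≡-Reasoning)

open Equivalence using (to; from)

private
  variable
    A B : Set

count : (A → Bool) → List A → ℕ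
count p xs = length (filterᵇ p xs)

count-++ : (p : A → Bool) (xs ys : List A) → count p (xs ++ ys) ≡ count p xs + count p ys
count-++ p xs ys = trans (cong length (filter-++ (T? ∘ p) xs ys)) (length-++ (filterᵇ p xs))

count-map : (p : B → Bool) (f : A → B) (xs : List A) → count p (map f xs) ≡ count (p ∘ f) xs
count-map p f []       = refl
count-map p f (x ∷ xs) with p (f x)
... | true  = cong suc (count-map p f xs)
... | false = count-map p f xs

count-≐ : {p q : A → Bool} → (∀ x → T (p x) ⇔ T (q x)) → (xs : List A) → count p xs ≡ count q xs
count-≐ {p = p} {q} p⇔q xs =
  cong length (filter-≐ (T? ∘ p) (T? ∘ q) ((λ {x} → to (p⇔q x)) , (λ {x} → from (p⇔q x))) xs)

count-none : (p : A → Bool) → (∀ x → ¬ T (p x)) → (xs : List A) → count p xs ≡ 0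
count-none p ¬p xs = cong length (filter-none (T? ∘ p) (universal ¬p xs))

count≡0⇒¬T : (p : A → Bool) (xs : List A) → count p xs ≡ 0 → ∀ {x} → x ∈ xs → ¬ T (p x)
count≡0⇒¬T p xs count≡0 x∈xs px =
  contradiction count≡0 (>⇒≢ (filter-some (T? ∘ p) (Any.map (λ { refl → px }) x∈xs)))

count-∷ : (p : A → Bool) (x : A) (xs : List A) → count p (x ∷ xs) ≡ (if p x then 1 else 0) + count p xs
count-∷ p x xs with p x
... | true  = refl
... | false = refl

count-const-∧ : (b : Bool) (p : A → Bool) (xs : List A) →
                count (λ x → b ∧ p x) xs ≡ (if b then count p xs else 0)
count-const-∧ true  p xs = refl
count-const-∧ false p xs = count-none (λ _ → false) (λ _ ()) xs

count-∧-split : (p q : A → Bool) (xs : List A) →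
                count (λ x → p x ∧ q x) xs + count (λ x → p x ∧ not (q x)) xs ≡ count p xs
count-∧-split p q []       = refl
count-∧-split p q (x ∷ xs) with p x | q x
... | true  | true  = cong suc (count-∧-split p q xs)
... | true  | false = trans (+-suc _ _) (cong suc (count-∧-split p q xs))
... | false | _     = count-∧-split p q xs

count-cartesianProduct : (P : A × B → Bool) (Q : A → Bool) (xs : List A) (ys : List B) →
                         (∀ x → count (λ y → P (x , y)) ys ≡ (if Q x then 1 else 0)) →
                         count P (cartesianProduct xs ys) ≡ count Q xs
count-cartesianProduct P Q []       ys fibre = refl
count-cartesianProduct P Q (x ∷ xs) ys fibre = begin
  count P (map (x ,_) ys ++ cartesianProduct xs ys)
    ≡⟨ count-++ P (map (x ,_) ys) (cartesianProduct xs ys) ⟩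
  count P (map (x ,_) ys) + count P (cartesianProduct xs ys)
    ≡⟨ cong₂ _+_ (trans (count-map P (x ,_) ys) (fibre x)) (count-cartesianProduct P Q xs ys fibre) ⟩
  (if Q x then 1 else 0) + count Q xs
    ≡⟨ count-∷ Q x xs ⟨
  count Q (x ∷ xs) ∎
  where open ≡-Reasoning

T-allᵇ : (n : ℕ) (P : Fin n → Bool) → T (allᵇ n P) ⇔ (∀ i → T (P i))
T-allᵇ n P = mk⇔ (λ all-P i → lookup (all⁺ P (allFin n) all-P) (∈-allFin i))
                 (λ ∀P → all⁻ P (universal ∀P (allFin n)))

allTrue : {n : ℕ} → Vec Bool n → Bool
allTrue []      = true
allTrue (b ∷ s) = b ∧ allTrue s

T-allTrue : {n : ℕ} (s : Vec Bool n) → T (allTrue s) ⇔ (∀ i → T (Vec.lookup s i))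
T-allTrue s = mk⇔ (to′ s) (from′ s)
  where
  to′ : {n : ℕ} (s : Vec Bool n) → T (allTrue s) → ∀ i → T (Vec.lookup s i)
  to′ (true ∷ s) all-s zero    = _
  to′ (true ∷ s) all-s (suc i) = to′ s all-s i
  from′ : {n : ℕ} (s : Vec Bool n) → (∀ i → T (Vec.lookup s i)) → T (allTrue s)
  from′ []      ∀s = _
  from′ (b ∷ s) ∀s = from T-∧ (∀s zero , from′ s (∀s ∘ suc))

count-allTrue-allSigns : (n : ℕ) → count allTrue (allSigns n) ≡ 1
count-allTrue-allSigns zero    = refl
count-allTrue-allSigns (suc n) = begin
  count allTrue (map (true ∷_) S ++ map (false ∷_) S ++ [])
    ≡⟨ count-++ allTrue (map (true ∷_) S) _ ⟩
  count allTrue (map (true ∷_) S) + count allTrue (map (false ∷_) S ++ [])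
    ≡⟨ cong (count allTrue (map (true ∷_) S) +_) (count-++ allTrue (map (false ∷_) S) []) ⟩
  count allTrue (map (true ∷_) S) + (count allTrue (map (false ∷_) S) + 0)
    ≡⟨ cong₂ (λ a b → a + (b + 0)) (count-map allTrue (true ∷_) S) (count-map allTrue (false ∷_) S) ⟩
  count allTrue S + (count (λ _ → false) S + 0)
    ≡⟨ cong₂ (λ a b → a + (b + 0)) (count-allTrue-allSigns n) (count-none (λ _ → false) (λ _ ()) S) ⟩
  1 ∎
  where
  open ≡-Reasoning
  S : List (Vec Bool n)
  S = allSigns n

module _ {n : ℕ} (π : Vec (Fin n) n) (s : Vec Bool n) where

  plusCount+minusCount≡fixedPoints : plusCount π s + minusCount π s ≡ fixedPoints π
  plusCount+minusCount≡fixedPoints = count-∧-split (isFixed π) (Vec.lookup s) (allFin n)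

  allTrue⇒signsNormalised : T (allTrue s) → T (signsNormalised π s)
  allTrue⇒signsNormalised all-s = from (T-allᵇ n _) normalisedAt
    where
    normalisedAt : ∀ i → T (if isFixed π i then true else Vec.lookup s i)
    normalisedAt i with isFixed π i
    ... | true  = _
    ... | false = to (T-allTrue s) all-s i

  allTrue⇒minusCount≡0 : T (allTrue s) → minusCount π s ≡ 0
  allTrue⇒minusCount≡0 all-s = count-none _ noMinusAt (allFin n)
    where
    noMinusAt : ∀ i → ¬ T (isFixed π i ∧ not (Vec.lookup s i))
    noMinusAt i with isFixed π i | Vec.lookup s i | to (T-allTrue s) all-s i
    ... | true  | true | _ = λ ()
    ... | false | _    | _ = λ ()

  allTrue⇒plusCount≡fixedPoints : T (allTrue s) → plusCount π s ≡ fixedPoints π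
  allTrue⇒plusCount≡fixedPoints all-s = begin
    plusCount π s                  ≡⟨ +-identityʳ _ ⟨
    plusCount π s + 0              ≡⟨ cong (plusCount π s +_) (allTrue⇒minusCount≡0 all-s) ⟨
    plusCount π s + minusCount π s ≡⟨ plusCount+minusCount≡fixedPoints ⟩
    fixedPoints π                  ∎
    where open ≡-Reasoning

  signsNormalised∧minusCount≡0⇒allTrue : T (signsNormalised π s) → minusCount π s ≡ 0 → T (allTrue s)
  signsNormalised∧minusCount≡0⇒allTrue normalised noMinus = from (T-allTrue s) plusAt
    where
    plusAt : ∀ i → T (Vec.lookup s i)
    plusAt i with isFixed π i | Vec.lookup s i
               | to (T-allᵇ n _) normalised i
               | count≡0⇒¬T _ (allFin n) noMinus (∈-allFin i)
    ... | _     | true  | _          | _         = _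
    ... | false | false | normalised | _         = normalised
    ... | true  | false | _          | notMinus  = contradiction _ notMinus

m+2*n≡o+n⇔m≡o∸n : ∀ m {n o} → n ≤ o → (m + 2 * n ≡ o + n) ⇔ (m ≡ o ∸ n)
m+2*n≡o+n⇔m≡o∸n m {n} {o} n≤o = mk⇔
  (λ eq → trans (sym (m+n∸n≡m m n)) (cong (_∸ n) (+-cancelʳ-≡ n _ _ (trans (sym (shape m n)) eq))))
  (λ eq → trans (shape m n) (cong (_+ n) (trans (cong (_+ n) eq) (m∸n+n≡m n≤o))))
  where
  shape : ∀ m n → m + 2 * n ≡ m + n + n
  shape = solve-∀

m+n+o≡p⇒m+o≡n+p⇒n≡0 : ∀ m n o {p} → m + n + o ≡ p → m + o ≡ n + p → n ≡ 0
m+n+o≡p⇒m+o≡n+p⇒n≡0 m n o {p} total balance =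
  m+n≡0⇒m≡0 n (+-cancelʳ-≡ (m + o) (n + n) 0 (begin
    n + n + (m + o)   ≡⟨ shape m n o ⟩
    n + (m + n + o)   ≡⟨ cong (n +_) total ⟩
    n + p             ≡⟨ balance ⟨
    m + o             ∎))
  where
  open ≡-Reasoning
  shape : ∀ m n o → n + n + (m + o) ≡ n + (m + n + o)
  shape = solve-∀

module _ {n : ℕ} (π : Vec (Fin n) n) (s : Vec Bool n) {k p : ℕ} (k≤p : k ≤ p) where

  private
    F P M : ℕ
    F = fixedPoints π
    P = plusCount π s
    M = minusCount π s

  signedInvolution⇔allPlus :
    T (isInvolution π ∧ signsNormalised π s ∧ ((P + k) ≡ᵇ (M + p)) ∧ ((F + 2 * k) ≡ᵇ (p + k)))
    ⇔ T ((isInvolution π ∧ (F ≡ᵇ (p ∸ k))) ∧ allTrue s)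
  signedInvolution⇔allPlus = mk⇔ forget remember
    where
    forget : T (isInvolution π ∧ signsNormalised π s ∧ ((P + k) ≡ᵇ (M + p)) ∧ ((F + 2 * k) ≡ᵇ (p + k)))
           → T ((isInvolution π ∧ (F ≡ᵇ (p ∸ k))) ∧ allTrue s)
    forget signed =
      let involution , rest     = to T-∧ signed
          normalised , rest′    = to T-∧ rest
          balanced   , sized    = to T-∧ rest′
          F≡p∸k = to (m+2*n≡o+n⇔m≡o∸n F k≤p) (≡ᵇ⇒≡ (F + 2 * k) (p + k) sized)
          total = trans (cong (_+ k) (trans (plusCount+minusCount≡fixedPoints π s) F≡p∸k)) (m∸n+n≡m k≤p)
          noMinus = m+n+o≡p⇒m+o≡n+p⇒n≡0 P M k total (≡ᵇ⇒≡ (P + k) (M + p) balanced)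
      in from T-∧ ( from T-∧ (involution , ≡⇒≡ᵇ F (p ∸ k) F≡p∸k)
                  , signsNormalised∧minusCount≡0⇒allTrue π s normalised noMinus)
    remember : T ((isInvolution π ∧ (F ≡ᵇ (p ∸ k))) ∧ allTrue s)
             → T (isInvolution π ∧ signsNormalised π s ∧ ((P + k) ≡ᵇ (M + p)) ∧ ((F + 2 * k) ≡ᵇ (p + k)))
    remember plain =
      let fixedCondition , allPlus = to T-∧ plain
          involution     , fixed   = to T-∧ fixedCondition
          F≡p∸k   = ≡ᵇ⇒≡ F (p ∸ k) fixed
          balance = trans (cong (_+ k) (trans (allTrue⇒plusCount≡fixedPoints π s allPlus) F≡p∸k))
                          (trans (m∸n+n≡m k≤p) (sym (cong (_+ p) (allTrue⇒minusCount≡0 π s allPlus))))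
      in from T-∧ ( involution
                  , from T-∧ ( allTrue⇒signsNormalised π s allPlus
                             , from T-∧ ( ≡⇒≡ᵇ (P + k) (M + p) balance
                                        , ≡⇒≡ᵇ (F + 2 * k) (p + k) (from (m+2*n≡o+n⇔m≡o∸n F k≤p) F≡p∸k))))

count-signedInvolutions : ∀ {n} (π : Vec (Fin n) n) {k p} → k ≤ p →
  count (λ s → isInvolution π ∧ signsNormalised π s
               ∧ ((plusCount π s + k) ≡ᵇ (minusCount π s + p))
               ∧ ((fixedPoints π + 2 * k) ≡ᵇ (p + k)))
        (allSigns n)
  ≡ (if isInvolution π ∧ (fixedPoints π ≡ᵇ (p ∸ k)) then 1 else 0)
count-signedInvolutions {n} π {k} {p} k≤p = begin
  count _ (allSigns n)
    ≡⟨ count-≐ (λ s → signedInvolution⇔allPlus π s k≤p) (allSigns n) ⟩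
  count (λ s → involutionWithFixedPoints ∧ allTrue s) (allSigns n)
    ≡⟨ count-const-∧ involutionWithFixedPoints allTrue (allSigns n) ⟩
  (if involutionWithFixedPoints then count allTrue (allSigns n) else 0)
    ≡⟨ cong (if involutionWithFixedPoints then_else 0) (count-allTrue-allSigns n) ⟩
  (if involutionWithFixedPoints then 1 else 0) ∎
  where
  open ≡-Reasoning
  involutionWithFixedPoints : Bool
  involutionWithFixedPoints = isInvolution π ∧ (fixedPoints π ≡ᵇ (p ∸ k))

γ[k,p,k]≡c[p+k,p∸k] : (k p : ℕ) → k ≤ p → γ k p k ≡ c (p + k) (p ∸ k)
γ[k,p,k]≡c[p+k,p∸k] k p k≤p =
  count-cartesianProduct _ _ (allMaps (p + k)) (allSigns (p + k))
    (λ π → count-signedInvolutions π k≤p)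

[1+n]%2≡1⇒n%2≡0 : ∀ n → suc n % 2 ≡ 1 → n % 2 ≡ 0
[1+n]%2≡1⇒n%2≡0 zero          _  = refl
[1+n]%2≡1⇒n%2≡0 (suc zero)    ()
[1+n]%2≡1⇒n%2≡0 (suc (suc n)) eq = [1+n]%2≡1⇒n%2≡0 n eq

[m+n]%2≡m%2⇒n%2≡0 : ∀ m n → (m + n) % 2 ≡ m % 2 → n % 2 ≡ 0
[m+n]%2≡m%2⇒n%2≡0 zero          n eq = eq
[m+n]%2≡m%2⇒n%2≡0 (suc zero)    n eq = [1+n]%2≡1⇒n%2≡0 n eq
[m+n]%2≡m%2⇒n%2≡0 (suc (suc m)) n eq = [m+n]%2≡m%2⇒n%2≡0 m n eq

c[n,r]≡γ[[n∸r]/2,[n+r]/2,[n∸r]/2] : (n r : ℕ) → r ≤ n → n % 2 ≡ r % 2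
  → c n r ≡ γ ((n ∸ r) / 2) ((n + r) / 2) ((n ∸ r) / 2)
c[n,r]≡γ[[n∸r]/2,[n+r]/2,[n∸r]/2] n r r≤n parity
  with m%n≡0⇒n∣m (n ∸ r) 2 ([m+n]%2≡m%2⇒n%2≡0 r (n ∸ r) (trans (cong (_% 2) (m+[n∸m]≡n r≤n)) parity))
... | divides m n∸r≡m*2 = begin
  c n r                                               ≡⟨ cong₂ c n≡r+m+m (sym (m+n∸n≡m r m)) ⟩
  c (r + m + m) (r + m ∸ m)                           ≡⟨ γ[k,p,k]≡c[p+k,p∸k] m (r + m) (m≤n+m m r) ⟨
  γ m (r + m) m                                       ≡⟨ cong₂ (λ k p → γ k p k) [n∸r]/2≡m [n+r]/2≡r+m ⟨
  γ ((n ∸ r) / 2) ((n + r) / 2) ((n ∸ r) / 2)         ∎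
  where
  open ≡-Reasoning
  n≡r+m+m : n ≡ r + m + m
  n≡r+m+m = begin
    n             ≡⟨ m+[n∸m]≡n r≤n ⟨
    r + (n ∸ r)   ≡⟨ cong (r +_) n∸r≡m*2 ⟩
    r + m * 2     ≡⟨ shape r m ⟩
    r + m + m     ∎
    where
    shape : ∀ r m → r + m * 2 ≡ r + m + m
    shape = solve-∀
  [n∸r]/2≡m : (n ∸ r) / 2 ≡ m
  [n∸r]/2≡m = trans (cong (_/ 2) n∸r≡m*2) (m*n/n≡m m 2)
  [n+r]/2≡r+m : (n + r) / 2 ≡ r + m
  [n+r]/2≡r+m = trans (cong (λ x → (x + r) / 2) n≡r+m+m) (trans (cong (_/ 2) (shape r m)) (m*n/n≡m (r + m) 2))
    where
    shape : ∀ r m → r + m + m + r ≡ (r + m) * 2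
    shape = solve-∀

corollary4p2 : ((k p : ℕ) → k ≤ p → γ k p k ≡ c (p + k) (p ∸ k))
    × ((n r : ℕ) → r ≤ n → n % 2 ≡ r % 2
       → c n r ≡ γ ((n ∸ r) / 2) ((n + r) / 2) ((n ∸ r) / 2))
corollary4p2 = γ[k,p,k]≡c[p+k,p∸k] , c[n,r]≡γ[[n∸r]/2,[n+r]/2,[n∸r]/2]
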